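{- Let $(V^1,V^2)$ be an $(\varepsilon,\delta)$-super-regular pair in a graph, and let $f>0$. Suppose $W^1\supseteq V^1$ and $W^2\supseteq V^2$ are disjoint vertex sets with $|W^h|\le(1+f\varepsilon)|V^h|$ for $h=1,2$, and set $$\varepsilon'=\max\{2f,1+f\}\,\varepsilon,\qquad \delta'=\min\{1/4,\,1/(1+f\varepsilon)\}\,\delta.$$ Suppose that each vertex of $W^1\setminus V^1$ has at least $\delta'|W^2|$ neighbours in $W^2$, and each vertex of $W^2\setminus V^2$ has at least $\delta'|W^1|$ neighbours in $W^1$. Then $(W^1,W^2)$ is an $(\varepsilon',\delta')$-super-regular pair.
   Context: For disjoint vertex sets $X,Y$ in a graph, the density $d(X,Y)$ is the number of edges between $X$ and $Y$ divided by $|X||Y|$. A pair $(V_1,V_2)$ of disjoint vertex sets is $(\varepsilon,\delta)$-dense if $d(U_1,U_2)\ge\delta$ for all $U_1\subseteq V_1$, $U_2\subseteq V_2$ with $|U_1|\ge\varepsilon|V_1|$ and $|U_2|\ge\varepsilon|V_2|$. It is $(\varepsilon,\delta)$-super-regular if it is $(\varepsilon,\delta)$-dense and every vertex of $V_1$ has at least $\delta|V_2|$ neighbours in $V_2$ and every vertex of $V_2$ has at least $\delta|V_1|$ neighbours in $V_1$.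
   Formalization: The parameters ε, δ and f are taken in the rationals, so the derived parameters ε′ and δ′ are rational as well. -}

module Defs where

open import Data.Nat using (ℕ)
open import Data.Bool using (Bool; true; false; _∧_; if_then_else_)
open import Data.Fin using (Fin)
open import Data.Fin.Subset using (Subset; _∈_; _∉_; _⊆_; _─_; ∣_∣)
open import Data.List using (List; map; allFin)
open import Data.Nat.ListAction using () renaming (sum to sumℕ)
open import Data.Vec using (lookup)
open import Data.Integer using (+_)
open import Data.Rational using (ℚ; 0ℚ; 1ℚ; _≤_; _<_; _*_; _+_; _⊔_; _⊓_; 1/_; _/_)
open import Data.Rational.Properties using (_<?_; pos⇒nonZero)
open import Data.Rational.Base using (positive)
open import Relation.Nullary using (yes; no)
open import Relation.Binary.PropositionalEquality using (_≡_)
open import Data.Empty using (⊥)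

record Graph (n : ℕ) : Set where
  field
    adj   : Fin n → Fin n → Bool
    sym   : ∀ x y → adj x y ≡ adj y x
    irrefl : ∀ x → adj x x ≡ false

open Graph public

ℕ→ℚ : ℕ → ℚ
ℕ→ℚ k = + k / 1

private
  b2n : Bool → ℕ
  b2n true = 1
  b2n false = 0

-- number of edges with one end in X and the other end in Y (ordered count x∈X, y∈Y)
edges : ∀ {n} → Graph n → Subset n → Subset n → ℕ
edges {n} G X Y =
  sumℕ (map (λ x → sumℕ (map (λ y → b2n (lookup X x ∧ (lookup Y y ∧ adj G x y))) (allFin n))) (allFin n))

deg : ∀ {n} → Graph n → Fin n → Subset n → ℕ
deg {n} G v Y = sumℕ (map (λ y → b2n (lookup Y y ∧ adj G v y)) (allFin n))

Disjoint : ∀ {n} → Subset n → Subset n → Set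
Disjoint X Y = ∀ x → x ∈ X → x ∉ Y

-- d(X,Y) ≥ δ, written multiplicatively: e(X,Y) ≥ δ |X| |Y|
-- (equivalent to e(X,Y)/(|X||Y|) ≥ δ whenever X, Y are nonempty)
DensityAtLeast : ∀ {n} → Graph n → Subset n → Subset n → ℚ → Set
DensityAtLeast G X Y δ = δ * (ℕ→ℚ ∣ X ∣ * ℕ→ℚ ∣ Y ∣) ≤ ℕ→ℚ (edges G X Y)

IsDense : ∀ {n} → Graph n → ℚ → ℚ → Subset n → Subset n → Set
IsDense G ε δ V₁ V₂ =
  ∀ U₁ U₂ → U₁ ⊆ V₁ → U₂ ⊆ V₂ →
  ε * ℕ→ℚ ∣ V₁ ∣ ≤ ℕ→ℚ ∣ U₁ ∣ → ε * ℕ→ℚ ∣ V₂ ∣ ≤ ℕ→ℚ ∣ U₂ ∣ →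
  DensityAtLeast G U₁ U₂ δ

IsSuperRegular : ∀ {n} → Graph n → ℚ → ℚ → Subset n → Subset n → Set
IsSuperRegular G ε δ V₁ V₂ =
  Disjoint V₁ V₂ × IsDense G ε δ V₁ V₂ ×
  (∀ v → v ∈ V₁ → δ * ℕ→ℚ ∣ V₂ ∣ ≤ ℕ→ℚ (deg G v V₂)) ×
  (∀ v → v ∈ V₂ → δ * ℕ→ℚ ∣ V₁ ∣ ≤ ℕ→ℚ (deg G v V₁))
  where open import Data.Product using (_×_)

-- 1/p for p > 0 (junk value 0 otherwise; only used at positive arguments)
invPos : ℚ → ℚ
invPos p with 0ℚ <? p
... | yes h = 1/_ p {{pos⇒nonZero p {{positive h}}}}
... | no _ = 0ℚ

epsPrime : ℚ → ℚ → ℚ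
epsPrime f ε = ((ℕ→ℚ 2 * f) ⊔ (1ℚ + f)) * ε

deltaPrime : ℚ → ℚ → ℚ → ℚ
deltaPrime f ε δ = ((+ 1 / 4) ⊓ invPos (1ℚ + f * ε)) * δ

-- Take Uʰ ⊆ Wʰ with |Uʰ| ≥ ε′|Wʰ|. Since |Wʰ ─ Vʰ| ≤ fε|Vʰ|, at most fε|Vʰ| vertices of Uʰ
-- lie outside Vʰ, and fε|Vʰ| ≤ |Uʰ|/2 because ε′ ≥ 2fε, while |Uʰ| ≥ (1+f)ε|Vʰ| because
-- ε′ ≥ (1+f)ε. So Uʰ ∩ Vʰ has at least ε|Vʰ| and at least |Uʰ|/2 vertices, and density of
-- (V¹,V²) gives e(U¹,U²) ≥ δ|U¹ ∩ V¹||U² ∩ V²| ≥ (δ/4)|U¹||U²| ≥ δ′|U¹||U²|. A vertex of V¹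
-- keeps at least δ|V²| ≥ δ|W²|/(1+fε) ≥ δ′|W²| neighbours in W²; the vertices of W¹ ─ V¹ are
-- covered by hypothesis. For δ ≤ 0 every bound is trivial, as then δ′ ≤ 0.

module Submission where

open import Defs
open import Data.Nat using (ℕ)
open import Data.Fin.Subset using (Subset; _∈_; _⊆_; _─_; ∣_∣)
open import Data.Rational using (ℚ; 0ℚ; 1ℚ; _≤_; _<_; _*_; _+_)

open import Data.Bool using (Bool; true; false; _∧_; T)
open import Data.Bool.Properties using (T-∧; T-≡)
open import Data.Empty using (⊥-elim)
open import Data.Fin using (Fin; zero; suc)
open import Data.Fin.Subset using (inside; outside; _∩_; _∪_)
open import Data.Fin.Subset.Properties
  using (p⊆q⇒∣p∣≤∣q∣; p∩q⊆p; p∩q⊆q; x∈p∪q⁻; x∈p∧x∉q⇒x∈p─q; _∈?_)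
open import Data.Integer as ℤ using (+_)
import Data.Integer.Properties as ℤ
open import Data.List using (List; []; _∷_; map; allFin)
import Data.Nat as ℕ
import Data.Nat.Coprimality as Coprimality
open import Data.Nat.ListAction using (sum)
import Data.Nat.Properties as ℕ
open import Data.Product using (Σ; _×_; _,_; proj₁; proj₂)
import Data.Product as Product
open import Data.Rational using (Positive; NonZero; mkℚ; *≤*; *<*; -_; _/_; _⊓_; 1/_; nonNegative; positive)
open import Data.Rational.Properties
open import Data.Rational.Solver using (module +-*-Solver)
open import Data.Sum using (inj₁; inj₂; [_,_]′)
open import Data.Unit using (tt)
open import Data.Vec using ([]; _∷_; lookup)
open import Data.Vec.Properties using ([]=⇒lookup; lookup⇒[]=)
open import Function using (_∘_; id; Equivalence)
open import Relation.Binary.PropositionalEquality as ≡ using (_≡_; refl; cong; cong₂)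
open import Relation.Nullary using (yes; no)
open ≤-Reasoning

open +-*-Solver using (solve; _:+_; _:*_; :-_; _:=_; con)

twoVertexGraph : Bool → Graph 2
twoVertexGraph b = record { adj = adj₂ ; sym = sym₂ ; irrefl = irrefl₂ }
  where
  adj₂ : Fin 2 → Fin 2 → Bool
  adj₂ zero    zero    = false
  adj₂ zero    (suc _) = b
  adj₂ (suc _) zero    = b
  adj₂ (suc _) (suc _) = false
  sym₂ : ∀ x y → adj₂ x y ≡ adj₂ y x
  sym₂ zero    zero    = refl
  sym₂ zero    (suc _) = refl
  sym₂ (suc _) zero    = refl
  sym₂ (suc _) (suc _) = refl
  irrefl₂ : ∀ x → adj₂ x x ≡ false
  irrefl₂ zero    = refl
  irrefl₂ (suc _) = refl

-- Defs keeps the 0/1 indicator Bool → ℕ summed in deg and edges private; unification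
-- recovers it from a degree in twoVertexGraph b, where it is applied to the variable b.
indicator : Σ (Bool → ℕ) λ χ → ∀ b → χ b ℕ.+ 0 ≡ deg (twoVertexGraph b) zero (outside ∷ inside ∷ [])
indicator = _ , λ _ → refl

χ : Bool → ℕ
χ = proj₁ indicator

χ-mono : ∀ {a b} → (T a → T b) → χ a ℕ.≤ χ b
χ-mono {false}         _   = ℕ.z≤n
χ-mono {true}  {true}  _   = ℕ.≤-refl
χ-mono {true}  {false} a⇒b = ⊥-elim (a⇒b tt)

T-∧-mono : ∀ {a a′ b b′} → (T a → T a′) → (T b → T b′) → T (a ∧ b) → T (a′ ∧ b′)
T-∧-mono a⇒a′ b⇒b′ = Equivalence.from T-∧ ∘ Product.map a⇒a′ b⇒b′ ∘ Equivalence.to T-∧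

sum-map-mono : ∀ {A : Set} {f g : A → ℕ} (xs : List A) → (∀ x → f x ℕ.≤ g x) →
               sum (map f xs) ℕ.≤ sum (map g xs)
sum-map-mono []       f≤g = ℕ.z≤n
sum-map-mono (x ∷ xs) f≤g = ℕ.+-mono-≤ (f≤g x) (sum-map-mono xs f≤g)

⊆⇒T-lookup : ∀ {n} {p q : Subset n} → p ⊆ q → ∀ x → T (lookup p x) → T (lookup q x)
⊆⇒T-lookup p⊆q x =
  Equivalence.from T-≡ ∘ []=⇒lookup ∘ p⊆q ∘ lookup⇒[]= x _ ∘ Equivalence.to T-≡

deg-mono : ∀ {n} (G : Graph n) v {Y Y′ : Subset n} → Y ⊆ Y′ → deg G v Y ℕ.≤ deg G v Y′
deg-mono {n} G v Y⊆Y′ =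
  sum-map-mono (allFin n) λ y → χ-mono (T-∧-mono (⊆⇒T-lookup Y⊆Y′ y) id)

edges-mono : ∀ {n} (G : Graph n) {X X′ Y Y′ : Subset n} → X ⊆ X′ → Y ⊆ Y′ →
             edges G X Y ℕ.≤ edges G X′ Y′
edges-mono {n} G X⊆X′ Y⊆Y′ =
  sum-map-mono (allFin n) λ x → sum-map-mono (allFin n) λ y →
    χ-mono (T-∧-mono (⊆⇒T-lookup X⊆X′ x) (T-∧-mono (⊆⇒T-lookup Y⊆Y′ y) id))

∣p∩q∣+∣p∪q∣≡∣p∣+∣q∣ : ∀ {n} (p q : Subset n) → ∣ p ∩ q ∣ ℕ.+ ∣ p ∪ q ∣ ≡ ∣ p ∣ ℕ.+ ∣ q ∣
∣p∩q∣+∣p∪q∣≡∣p∣+∣q∣ []            []            = refl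
∣p∩q∣+∣p∪q∣≡∣p∣+∣q∣ (outside ∷ p) (outside ∷ q) = ∣p∩q∣+∣p∪q∣≡∣p∣+∣q∣ p q
∣p∩q∣+∣p∪q∣≡∣p∣+∣q∣ (inside  ∷ p) (outside ∷ q) =
  ≡.trans (ℕ.+-suc ∣ p ∩ q ∣ ∣ p ∪ q ∣) (cong ℕ.suc (∣p∩q∣+∣p∪q∣≡∣p∣+∣q∣ p q))
∣p∩q∣+∣p∪q∣≡∣p∣+∣q∣ (outside ∷ p) (inside  ∷ q) =
  ≡.trans (ℕ.+-suc ∣ p ∩ q ∣ ∣ p ∪ q ∣)
        (≡.trans (cong ℕ.suc (∣p∩q∣+∣p∪q∣≡∣p∣+∣q∣ p q)) (≡.sym (ℕ.+-suc ∣ p ∣ ∣ q ∣)))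
∣p∩q∣+∣p∪q∣≡∣p∣+∣q∣ (inside  ∷ p) (inside  ∷ q) =
  cong ℕ.suc (≡.trans (ℕ.+-suc ∣ p ∩ q ∣ ∣ p ∪ q ∣)
                    (≡.trans (cong ℕ.suc (∣p∩q∣+∣p∪q∣≡∣p∣+∣q∣ p q)) (≡.sym (ℕ.+-suc ∣ p ∣ ∣ q ∣))))

∣p∣+∣q∣≤∣p∩q∣+∣r∣ : ∀ {n} {p q r : Subset n} → p ⊆ r → q ⊆ r → ∣ p ∣ ℕ.+ ∣ q ∣ ℕ.≤ ∣ p ∩ q ∣ ℕ.+ ∣ r ∣
∣p∣+∣q∣≤∣p∩q∣+∣r∣ {p = p} {q} p⊆r q⊆r = ℕ.≤-trans
  (ℕ.≤-reflexive (≡.sym (∣p∩q∣+∣p∪q∣≡∣p∣+∣q∣ p q)))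
  (ℕ.+-monoʳ-≤ ∣ p ∩ q ∣ (p⊆q⇒∣p∣≤∣q∣ ([ p⊆r , q⊆r ]′ ∘ x∈p∪q⁻ p q)))

0<1 : 0ℚ < 1ℚ
0<1 = *<* (ℤ.+<+ (ℕ.s≤s ℕ.z≤n))

0≤1 : 0ℚ ≤ 1ℚ
0≤1 = <⇒≤ 0<1

ℕ→ℚ≡mkℚ : ∀ k → ℕ→ℚ k ≡ mkℚ (+ k) 0 (Coprimality.sym (Coprimality.1-coprimeTo k))
ℕ→ℚ≡mkℚ k = normalize-coprime (Coprimality.sym (Coprimality.1-coprimeTo k))

ℕ→ℚ-mono-≤ : ∀ {m n} → m ℕ.≤ n → ℕ→ℚ m ≤ ℕ→ℚ n
ℕ→ℚ-mono-≤ {m} {n} m≤n rewrite ℕ→ℚ≡mkℚ m | ℕ→ℚ≡mkℚ n =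
  *≤* (≡.subst₂ ℤ._≤_ (≡.sym (ℤ.*-identityʳ (+ m))) (≡.sym (ℤ.*-identityʳ (+ n))) (ℤ.+≤+ m≤n))

ℕ→ℚ-homo-+ : ∀ m n → ℕ→ℚ (m ℕ.+ n) ≡ ℕ→ℚ m + ℕ→ℚ n
ℕ→ℚ-homo-+ m n rewrite ℕ→ℚ≡mkℚ m | ℕ→ℚ≡mkℚ n =
  cong₂ (λ i j → (i ℤ.+ j) / 1) (≡.sym (ℤ.*-identityʳ (+ m))) (≡.sym (ℤ.*-identityʳ (+ n)))

ℕ→ℚ-nonNeg : ∀ k → 0ℚ ≤ ℕ→ℚ k
ℕ→ℚ-nonNeg k = ℕ→ℚ-mono-≤ {0} {k} ℕ.z≤n

+-cancelʳ-≤ : ∀ {p q} r → p + r ≤ q + r → p ≤ q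
+-cancelʳ-≤ {p} {q} r p+r≤q+r = ≡.subst₂ _≤_ (+-cancel p) (+-cancel q) (+-monoˡ-≤ (- r) p+r≤q+r)
  where
  +-cancel : ∀ x → x + r + - r ≡ x
  +-cancel x = solve 2 (λ x r → x :+ r :+ :- r := x) refl x r

0≤* : ∀ {p q} → 0ℚ ≤ p → 0ℚ ≤ q → 0ℚ ≤ p * q
0≤* {p} {q} 0≤p 0≤q =
  nonNegative⁻¹ (p * q) {{nonNeg*nonNeg⇒nonNeg p {{nonNegative 0≤p}} q {{nonNegative 0≤q}}}}

*-mono-≤-nonNeg : ∀ {p q r s} → 0ℚ ≤ p → 0ℚ ≤ s → p ≤ q → r ≤ s → p * r ≤ q * s
*-mono-≤-nonNeg {p} {q} {r} {s} 0≤p 0≤s p≤q r≤s = begin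
  p * r ≤⟨ *-monoˡ-≤-nonNeg p {{nonNegative 0≤p}} r≤s ⟩
  p * s ≤⟨ *-monoʳ-≤-nonNeg s {{nonNegative 0≤s}} p≤q ⟩
  q * s ∎

invPos-nonNeg : ∀ p → 0ℚ ≤ invPos p
invPos-nonNeg p with 0ℚ <? p
... | yes 0<p = nonNegative⁻¹ (1/ p) {{pos⇒nonNeg (1/ p) {{1/pos⇒pos p}}}}
  where
  instance
    p-pos : Positive p
    p-pos = positive 0<p
    p-nonZero : NonZero p
    p-nonZero = pos⇒nonZero p
... | no  _   = ≤-refl

invPos-inverseˡ : ∀ {p} → 0ℚ < p → invPos p * p ≡ 1ℚ
invPos-inverseˡ {p} 0<p with 0ℚ <? p
... | yes 0<p′ = *-inverseˡ p {{pos⇒nonZero p {{positive 0<p′}}}}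
... | no  0≮p  = ⊥-elim (0≮p 0<p)

deltaPrime-coefficient-nonNeg : ∀ f ε → 0ℚ ≤ (+ 1 / 4) ⊓ invPos (1ℚ + f * ε)
deltaPrime-coefficient-nonNeg f ε = ⊓-glb 0≤1/4 (invPos-nonNeg (1ℚ + f * ε))
  where
  0≤1/4 : 0ℚ ≤ + 1 / 4
  0≤1/4 = *≤* (ℤ.+≤+ ℕ.z≤n)

deltaPrime-nonNeg : ∀ f ε {δ} → 0ℚ ≤ δ → 0ℚ ≤ deltaPrime f ε δ
deltaPrime-nonNeg f ε = 0≤* (deltaPrime-coefficient-nonNeg f ε)

deltaPrime-nonPos : ∀ f ε {δ} → δ ≤ 0ℚ → deltaPrime f ε δ ≤ 0ℚ
deltaPrime-nonPos f ε {δ} δ≤0 = begin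
  c * δ  ≤⟨ *-monoˡ-≤-nonNeg c {{nonNegative (deltaPrime-coefficient-nonNeg f ε)}} δ≤0 ⟩
  c * 0ℚ ≡⟨ *-zeroʳ c ⟩
  0ℚ     ∎
  where
  c : ℚ
  c = (+ 1 / 4) ⊓ invPos (1ℚ + f * ε)

deltaPrime≤δ/4 : ∀ f ε {δ} → 0ℚ ≤ δ → deltaPrime f ε δ ≤ + 1 / 4 * δ
deltaPrime≤δ/4 f ε {δ} 0≤δ = *-monoʳ-≤-nonNeg δ {{nonNegative 0≤δ}} (p⊓q≤p (+ 1 / 4) (invPos (1ℚ + f * ε)))

deltaPrime*[1+fε]≤δ : ∀ f ε {δ} → 0ℚ < 1ℚ + f * ε → 0ℚ ≤ δ → deltaPrime f ε δ * (1ℚ + f * ε) ≤ δ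
deltaPrime*[1+fε]≤δ f ε {δ} 0<p 0≤δ = begin
  (c * δ) * p        ≤⟨ *-monoʳ-≤-nonNeg p {{nonNegative (<⇒≤ 0<p)}}
                          (*-monoʳ-≤-nonNeg δ {{nonNegative 0≤δ}} (p⊓q≤q (+ 1 / 4) (invPos p))) ⟩
  (invPos p * δ) * p ≡⟨ solve 3 (λ i δ p → (i :* δ) :* p := (i :* p) :* δ) refl (invPos p) δ p ⟩
  (invPos p * p) * δ ≡⟨ cong (_* δ) (invPos-inverseˡ 0<p) ⟩
  1ℚ * δ             ≡⟨ *-identityˡ δ ⟩
  δ                  ∎
  where
  p c : ℚ
  p = 1ℚ + f * ε
  c = (+ 1 / 4) ⊓ invPos p

[1+f]ε≤epsPrime : ∀ f {ε} → 0ℚ ≤ ε → (1ℚ + f) * ε ≤ epsPrime f ε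
[1+f]ε≤epsPrime f {ε} 0≤ε = *-monoʳ-≤-nonNeg ε {{nonNegative 0≤ε}} (p≤q⊔p (ℕ→ℚ 2 * f) (1ℚ + f))

2fε≤epsPrime : ∀ f {ε} → 0ℚ ≤ ε → ℕ→ℚ 2 * f * ε ≤ epsPrime f ε
2fε≤epsPrime f {ε} 0≤ε = *-monoʳ-≤-nonNeg ε {{nonNegative 0≤ε}} (p≤p⊔q (ℕ→ℚ 2 * f) (1ℚ + f))

module _ {n} (f ε : ℚ) {U V W : Subset n} (U⊆W : U ⊆ W) (V⊆W : V ⊆ W)
         (|W|≤ : ℕ→ℚ ∣ W ∣ ≤ (1ℚ + f * ε) * ℕ→ℚ ∣ V ∣) where

  ∣U∣≤∣U∩V∣+fε∣V∣ : ℕ→ℚ ∣ U ∣ ≤ (ℕ→ℚ ∣ U ∩ V ∣) + f * ε * ℕ→ℚ ∣ V ∣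
  ∣U∣≤∣U∩V∣+fε∣V∣ = +-cancelʳ-≤ v (begin
    u + v                 ≡⟨ ℕ→ℚ-homo-+ ∣ U ∣ ∣ V ∣ ⟨
    ℕ→ℚ (∣ U ∣ ℕ.+ ∣ V ∣)   ≤⟨ ℕ→ℚ-mono-≤ (∣p∣+∣q∣≤∣p∩q∣+∣r∣ U⊆W V⊆W) ⟩
    ℕ→ℚ (∣ U ∩ V ∣ ℕ.+ ∣ W ∣) ≡⟨ ℕ→ℚ-homo-+ ∣ U ∩ V ∣ ∣ W ∣ ⟩
    i + ℕ→ℚ ∣ W ∣         ≤⟨ +-monoʳ-≤ i |W|≤ ⟩
    i + (1ℚ + f * ε) * v  ≡⟨ solve 4 (λ i f ε v → i :+ (con 1ℚ :+ f :* ε) :* v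
                                                 := (i :+ f :* ε :* v) :+ v) refl i f ε v ⟩
    (i + f * ε * v) + v   ∎)
    where
    u v i : ℚ
    u = ℕ→ℚ ∣ U ∣
    v = ℕ→ℚ ∣ V ∣
    i = ℕ→ℚ ∣ U ∩ V ∣

  ∣U∩V∣-large : 0ℚ ≤ f → 0ℚ ≤ ε → epsPrime f ε * ℕ→ℚ ∣ W ∣ ≤ ℕ→ℚ ∣ U ∣ →
                    ε * ℕ→ℚ ∣ V ∣ ≤ ℕ→ℚ ∣ U ∩ V ∣ × ℕ→ℚ ∣ U ∣ ≤ (ℕ→ℚ ∣ U ∩ V ∣) + (ℕ→ℚ ∣ U ∩ V ∣)
  ∣U∩V∣-large 0≤f 0≤ε ε′|W|≤|U| = ε|V|≤|U∩V| , |U|≤2|U∩V|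
    where
    u v i : ℚ
    u = ℕ→ℚ ∣ U ∣
    v = ℕ→ℚ ∣ V ∣
    i = ℕ→ℚ ∣ U ∩ V ∣
    0≤v : 0ℚ ≤ v
    0≤v = ℕ→ℚ-nonNeg ∣ V ∣
    0≤ε′ : 0ℚ ≤ epsPrime f ε
    0≤ε′ = ≤-trans (0≤* (+-mono-≤ 0≤1 0≤f) 0≤ε) ([1+f]ε≤epsPrime f 0≤ε)
    ε′|V|≤|U| : epsPrime f ε * v ≤ u
    ε′|V|≤|U| = ≤-trans (*-monoˡ-≤-nonNeg (epsPrime f ε) {{nonNegative 0≤ε′}}
                           (ℕ→ℚ-mono-≤ (p⊆q⇒∣p∣≤∣q∣ V⊆W)))
                        ε′|W|≤|U|
    ε|V|≤|U∩V| : ε * v ≤ i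
    ε|V|≤|U∩V| = +-cancelʳ-≤ (f * ε * v) (begin
      ε * v + f * ε * v  ≡⟨ solve 3 (λ f ε v → ε :* v :+ f :* ε :* v := (con 1ℚ :+ f) :* ε :* v)
                                     refl f ε v ⟩
      (1ℚ + f) * ε * v   ≤⟨ *-monoʳ-≤-nonNeg v {{nonNegative 0≤v}} ([1+f]ε≤epsPrime f 0≤ε) ⟩
      epsPrime f ε * v   ≤⟨ ε′|V|≤|U| ⟩
      u                  ≤⟨ ∣U∣≤∣U∩V∣+fε∣V∣ ⟩
      i + f * ε * v      ∎)
    |U|≤2|U∩V| : u ≤ i + i
    |U|≤2|U∩V| = +-cancelʳ-≤ u (begin
      u + u                                ≤⟨ +-mono-≤ ∣U∣≤∣U∩V∣+fε∣V∣ ∣U∣≤∣U∩V∣+fε∣V∣ ⟩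
      (i + f * ε * v) + (i + f * ε * v)    ≡⟨ solve 4 (λ i f ε v → (i :+ f :* ε :* v) :+ (i :+ f :* ε :* v)
                                                       := (i :+ i) :+ con (ℕ→ℚ 2) :* f :* ε :* v) refl i f ε v ⟩
      (i + i) + ℕ→ℚ 2 * f * ε * v          ≤⟨ +-monoʳ-≤ (i + i)
                                                (*-monoʳ-≤-nonNeg v {{nonNegative 0≤v}} (2fε≤epsPrime f 0≤ε)) ⟩
      (i + i) + epsPrime f ε * v           ≤⟨ +-monoʳ-≤ (i + i) ε′|V|≤|U| ⟩
      (i + i) + u                          ∎)

deltaPrime-bound-wlog : ∀ f ε {δ x} k → 0ℚ ≤ x →
                        (0ℚ ≤ δ → deltaPrime f ε δ * x ≤ ℕ→ℚ k) → deltaPrime f ε δ * x ≤ ℕ→ℚ k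
deltaPrime-bound-wlog f ε {δ} {x} k 0≤x bound with ≤-total 0ℚ δ
... | inj₁ 0≤δ = bound 0≤δ
... | inj₂ δ≤0 = begin
  deltaPrime f ε δ * x ≤⟨ *-monoʳ-≤-nonNeg x {{nonNegative 0≤x}} (deltaPrime-nonPos f ε δ≤0) ⟩
  0ℚ * x               ≡⟨ *-zeroˡ x ⟩
  0ℚ                   ≤⟨ ℕ→ℚ-nonNeg k ⟩
  ℕ→ℚ k                ∎

deltaPrime*-≤-δ*-halves : ∀ f ε {δ u₁ u₂ i₁ i₂} → 0ℚ ≤ δ → 0ℚ ≤ u₁ → 0ℚ ≤ u₂ →
                          u₁ ≤ i₁ + i₁ → u₂ ≤ i₂ + i₂ → deltaPrime f ε δ * (u₁ * u₂) ≤ δ * (i₁ * i₂)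
deltaPrime*-≤-δ*-halves f ε {δ} {u₁} {u₂} {i₁} {i₂} 0≤δ 0≤u₁ 0≤u₂ u₁≤2i₁ u₂≤2i₂ = begin
  δ′ * (u₁ * u₂)                          ≤⟨ *-monoˡ-≤-nonNeg δ′ {{nonNegative (deltaPrime-nonNeg f ε 0≤δ)}}
                                               (*-mono-≤-nonNeg 0≤u₁ 0≤2i₂ u₁≤2i₁ u₂≤2i₂) ⟩
  δ′ * ((i₁ + i₁) * (i₂ + i₂))            ≤⟨ *-monoʳ-≤-nonNeg ((i₁ + i₁) * (i₂ + i₂)) {{nonNegative (0≤* 0≤2i₁ 0≤2i₂)}}
                                               (deltaPrime≤δ/4 f ε 0≤δ) ⟩
  (+ 1 / 4 * δ) * ((i₁ + i₁) * (i₂ + i₂)) ≡⟨ solve 3 (λ δ i₁ i₂ → (con (+ 1 / 4) :* δ) :* ((i₁ :+ i₁) :* (i₂ :+ i₂))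
                                                                 := δ :* (i₁ :* i₂)) refl δ i₁ i₂ ⟩
  δ * (i₁ * i₂)                           ∎
  where
  δ′ : ℚ
  δ′ = deltaPrime f ε δ
  0≤2i₁ : 0ℚ ≤ i₁ + i₁
  0≤2i₁ = ≤-trans 0≤u₁ u₁≤2i₁
  0≤2i₂ : 0ℚ ≤ i₂ + i₂
  0≤2i₂ = ≤-trans 0≤u₂ u₂≤2i₂

IsDense-extend : ∀ {n} (G : Graph n) (ε δ f : ℚ) {V₁ V₂ W₁ W₂ : Subset n} → 0ℚ ≤ ε → 0ℚ ≤ f →
                 IsDense G ε δ V₁ V₂ → V₁ ⊆ W₁ → V₂ ⊆ W₂ →
                 ℕ→ℚ ∣ W₁ ∣ ≤ (1ℚ + f * ε) * ℕ→ℚ ∣ V₁ ∣ →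
                 ℕ→ℚ ∣ W₂ ∣ ≤ (1ℚ + f * ε) * ℕ→ℚ ∣ V₂ ∣ →
                 IsDense G (epsPrime f ε) (deltaPrime f ε δ) W₁ W₂
IsDense-extend G ε δ f {V₁} {V₂} 0≤ε 0≤f dense V₁⊆W₁ V₂⊆W₂ |W₁|≤ |W₂|≤
               U₁ U₂ U₁⊆W₁ U₂⊆W₂ large₁ large₂ =
  deltaPrime-bound-wlog f ε (edges G U₁ U₂) (0≤* 0≤u₁ 0≤u₂) λ 0≤δ → begin
    deltaPrime f ε δ * (ℕ→ℚ ∣ U₁ ∣ * ℕ→ℚ ∣ U₂ ∣)
      ≤⟨ deltaPrime*-≤-δ*-halves f ε {i₁ = ℕ→ℚ ∣ U₁ ∩ V₁ ∣} {ℕ→ℚ ∣ U₂ ∩ V₂ ∣}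
           0≤δ 0≤u₁ 0≤u₂ (proj₂ trace₁) (proj₂ trace₂) ⟩
    δ * (ℕ→ℚ ∣ U₁ ∩ V₁ ∣ * ℕ→ℚ ∣ U₂ ∩ V₂ ∣)
      ≤⟨ dense (U₁ ∩ V₁) (U₂ ∩ V₂) (p∩q⊆q U₁ V₁) (p∩q⊆q U₂ V₂) (proj₁ trace₁) (proj₁ trace₂) ⟩
    ℕ→ℚ (edges G (U₁ ∩ V₁) (U₂ ∩ V₂))
      ≤⟨ ℕ→ℚ-mono-≤ (edges-mono G (p∩q⊆p U₁ V₁) (p∩q⊆p U₂ V₂)) ⟩
    ℕ→ℚ (edges G U₁ U₂) ∎
  where
  0≤u₁ : 0ℚ ≤ ℕ→ℚ ∣ U₁ ∣
  0≤u₁ = ℕ→ℚ-nonNeg ∣ U₁ ∣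
  0≤u₂ : 0ℚ ≤ ℕ→ℚ ∣ U₂ ∣
  0≤u₂ = ℕ→ℚ-nonNeg ∣ U₂ ∣
  trace₁ : ε * ℕ→ℚ ∣ V₁ ∣ ≤ ℕ→ℚ ∣ U₁ ∩ V₁ ∣ ×
           ℕ→ℚ ∣ U₁ ∣ ≤ (ℕ→ℚ ∣ U₁ ∩ V₁ ∣) + (ℕ→ℚ ∣ U₁ ∩ V₁ ∣)
  trace₁ = ∣U∩V∣-large f ε U₁⊆W₁ V₁⊆W₁ |W₁|≤ 0≤f 0≤ε large₁
  trace₂ : ε * ℕ→ℚ ∣ V₂ ∣ ≤ ℕ→ℚ ∣ U₂ ∩ V₂ ∣ ×
           ℕ→ℚ ∣ U₂ ∣ ≤ (ℕ→ℚ ∣ U₂ ∩ V₂ ∣) + (ℕ→ℚ ∣ U₂ ∩ V₂ ∣)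
  trace₂ = ∣U∩V∣-large f ε U₂⊆W₂ V₂⊆W₂ |W₂|≤ 0≤f 0≤ε large₂

minDeg-extend : ∀ {n} (G : Graph n) (ε δ f : ℚ) {V₁ V₂ W₁ W₂ : Subset n} → 0ℚ < 1ℚ + f * ε →
                (∀ v → v ∈ V₁ → δ * ℕ→ℚ ∣ V₂ ∣ ≤ ℕ→ℚ (deg G v V₂)) → V₂ ⊆ W₂ →
                ℕ→ℚ ∣ W₂ ∣ ≤ (1ℚ + f * ε) * ℕ→ℚ ∣ V₂ ∣ →
                (∀ v → v ∈ (W₁ ─ V₁) → deltaPrime f ε δ * ℕ→ℚ ∣ W₂ ∣ ≤ ℕ→ℚ (deg G v W₂)) →
                ∀ v → v ∈ W₁ → deltaPrime f ε δ * ℕ→ℚ ∣ W₂ ∣ ≤ ℕ→ℚ (deg G v W₂)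
minDeg-extend G ε δ f {V₁} {V₂} {W₁} {W₂} 0<p minDeg V₂⊆W₂ |W₂|≤ new v v∈W₁ with v ∈? V₁
... | no  v∉V₁ = new v (x∈p∧x∉q⇒x∈p─q v∈W₁ v∉V₁)
... | yes v∈V₁ = deltaPrime-bound-wlog f ε (deg G v W₂) (ℕ→ℚ-nonNeg ∣ W₂ ∣) λ 0≤δ → begin
  δ′ * ℕ→ℚ ∣ W₂ ∣  ≤⟨ *-monoˡ-≤-nonNeg δ′ {{nonNegative (deltaPrime-nonNeg f ε 0≤δ)}} |W₂|≤ ⟩
  δ′ * (p * v₂)    ≡⟨ *-assoc δ′ p v₂ ⟨
  δ′ * p * v₂      ≤⟨ *-monoʳ-≤-nonNeg v₂ {{nonNegative (ℕ→ℚ-nonNeg ∣ V₂ ∣)}} (deltaPrime*[1+fε]≤δ f ε 0<p 0≤δ) ⟩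
  δ * v₂           ≤⟨ minDeg v v∈V₁ ⟩
  ℕ→ℚ (deg G v V₂) ≤⟨ ℕ→ℚ-mono-≤ (deg-mono G v V₂⊆W₂) ⟩
  ℕ→ℚ (deg G v W₂) ∎
  where
  δ′ p v₂ : ℚ
  δ′ = deltaPrime f ε δ
  p = 1ℚ + f * ε
  v₂ = ℕ→ℚ ∣ V₂ ∣

lemma2p9 : ∀ {n} (G : Graph n) (ε δ f : ℚ) (V₁ V₂ W₁ W₂ : Subset n) →
    0ℚ < ε → 0ℚ < f →
    IsSuperRegular G ε δ V₁ V₂ →
    V₁ ⊆ W₁ → V₂ ⊆ W₂ → Disjoint W₁ W₂ →
    ℕ→ℚ ∣ W₁ ∣ ≤ (1ℚ + f * ε) * ℕ→ℚ ∣ V₁ ∣ →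
    ℕ→ℚ ∣ W₂ ∣ ≤ (1ℚ + f * ε) * ℕ→ℚ ∣ V₂ ∣ →
    (∀ v → v ∈ (W₁ ─ V₁) → deltaPrime f ε δ * ℕ→ℚ ∣ W₂ ∣ ≤ ℕ→ℚ (deg G v W₂)) →
    (∀ v → v ∈ (W₂ ─ V₂) → deltaPrime f ε δ * ℕ→ℚ ∣ W₁ ∣ ≤ ℕ→ℚ (deg G v W₁)) →
    IsSuperRegular G (epsPrime f ε) (deltaPrime f ε δ) W₁ W₂
lemma2p9 G ε δ f V₁ V₂ W₁ W₂ 0<ε 0<f (_ , dense , minDeg₁ , minDeg₂) V₁⊆W₁ V₂⊆W₂ W₁#W₂
         |W₁|≤ |W₂|≤ new₁ new₂ =
  W₁#W₂ ,
  IsDense-extend G ε δ f 0≤ε 0≤f dense V₁⊆W₁ V₂⊆W₂ |W₁|≤ |W₂|≤ ,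
  minDeg-extend G ε δ f 0<1+fε minDeg₁ V₂⊆W₂ |W₂|≤ new₁ ,
  minDeg-extend G ε δ f 0<1+fε minDeg₂ V₁⊆W₁ |W₁|≤ new₂
  where
  0≤ε : 0ℚ ≤ ε
  0≤ε = <⇒≤ 0<ε
  0≤f : 0ℚ ≤ f
  0≤f = <⇒≤ 0<f
  0<1+fε : 0ℚ < 1ℚ + f * ε
  0<1+fε = +-mono-<-≤ 0<1 (0≤* 0≤f 0≤ε)
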